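{- Let $P$ be a poset and $\theta$ a contraction congruence on $P$. Then $P/\theta$ equipped with the transitive closure of the quotient relation $\leqslant_\theta$ is a well-defined poset.
   Context: A map $f\colon P\to Q$ between posets is a contraction if (i) it is an order-preserving surjection, (ii) each fibre $f^{ -1}(q)$ is connected (its Hasse diagram, i.e. the graph with an edge for each covering relation among its elements in the induced order, is connected), and (iii) for every covering relation $q\lessdot q'$ in $Q$ there is a covering relation $p\lessdot p'$ in $P$ with $f(p)=q$, $f(p')=q'$. A contraction congruence is the kernel $\{(p,p')\mid f(p)=f(p')\}$ of a contraction. $P/\theta$ is the set of classes $[p]$ and $[p]\leqslant_\theta[q]$ iff there exist $p'\in[p]$, $q'\in[q]$ with $p'\leqslant q'$. -}

module Defs where

open import Level using (Level; _⊔_)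
open import Data.Product using (Σ; ∃; ∃-syntax; _×_; _,_)
open import Relation.Nullary using (¬_)
open import Relation.Binary.Bundles using (Poset)
open import Relation.Binary.Core using (Rel)
open import Relation.Binary.Construct.Closure.Symmetric using (SymClosure)
open import Relation.Binary.Construct.Closure.ReflexiveTransitive using (Star)
open import Relation.Binary.Construct.Closure.Transitive using (TransClosure)

module _ {c ℓ₁ ℓ₂ : Level} (P : Poset c ℓ₁ ℓ₂) where
  open Poset P renaming (Carrier to A)

  _<ₚ_ : Rel A (ℓ₁ ⊔ ℓ₂)
  x <ₚ y = x ≤ y × ¬ (x ≈ y)

  Covers : Rel A (c ⊔ ℓ₁ ⊔ ℓ₂)
  Covers x y = x <ₚ y × ¬ (∃[ z ] (x <ₚ z × z <ₚ y))

  CoversIn : {ℓ : Level} → (A → Set ℓ) → Rel A (c ⊔ ℓ₁ ⊔ ℓ₂ ⊔ ℓ)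
  CoversIn S x y = S x × S y × x <ₚ y × ¬ (∃[ z ] (S z × x <ₚ z × z <ₚ y))

  -- S is connected: the Hasse diagram of S (with the induced order) is connected,
  -- i.e. any two elements of S are joined by a path of covering relations of S
  -- (up to the poset's equality ≈).
  Connected : {ℓ : Level} → (A → Set ℓ) → Set (c ⊔ ℓ₁ ⊔ ℓ₂ ⊔ ℓ)
  Connected S = ∀ x y → S x → S y →
    ∃[ y' ] (Star (SymClosure (CoversIn S)) x y' × y' ≈ y)

module _ {c ℓ₁ ℓ₂ c' ℓ₁' ℓ₂' : Level}
         (P : Poset c ℓ₁ ℓ₂) (Q : Poset c' ℓ₁' ℓ₂') where
  private
    module P = Poset P
    module Q = Poset Q

  record IsContraction (f : P.Carrier → Q.Carrier)
         : Set (c ⊔ ℓ₁ ⊔ ℓ₂ ⊔ c' ⊔ ℓ₁' ⊔ ℓ₂') where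
    field
      order-preserving : ∀ {x y} → x P.≤ y → f x Q.≤ f y
      surjective       : ∀ q → ∃[ p ] (f p Q.≈ q)
      fibres-connected : ∀ q → Connected P (λ p → f p Q.≈ q)
      covers-lift      : ∀ {q q'} → Covers Q q q' →
                           ∃[ p ] ∃[ p' ] (Covers P p p' × f p Q.≈ q × f p' Q.≈ q')

  Kernel : (f : P.Carrier → Q.Carrier) → Rel P.Carrier ℓ₁'
  Kernel f x y = f x Q.≈ f y

-- quotient relation ≤_θ on P/θ, with classes represented by elements of P:
-- [x] ≤θ [y] iff ∃ x' ∈ [x], y' ∈ [y] with x' ≤ y'
module _ {c ℓ₁ ℓ₂ : Level} (P : Poset c ℓ₁ ℓ₂) where
  open Poset P renaming (Carrier to A)

  QuotLeq : {ℓ : Level} → Rel A ℓ → Rel A (c ⊔ ℓ₂ ⊔ ℓ)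
  QuotLeq θ x y = ∃[ x' ] ∃[ y' ] (θ x x' × θ y y' × x' ≤ y')

  QuotLeq⁺ : {ℓ : Level} → Rel A ℓ → Rel A (c ⊔ ℓ₂ ⊔ ℓ)
  QuotLeq⁺ θ = TransClosure (QuotLeq θ)

-- Along an order-preserving map f : P → Q, every generating step [x] ≤θ [y]
-- of the quotient relation gives f x ≤ f y, hence so does its transitive
-- closure. Antisymmetry in Q then forces f x ≈ f y, i.e. x θ y, whenever
-- [x] and [y] are related both ways.
module Submission where

open import Defs
open import Level using (Level)
open import Data.Product using (_,_)
open import Function using (_on_)
open import Relation.Binary.Core using (Rel; _⇒_)
open import Relation.Binary.Definitions using (Transitive)
open import Relation.Binary.Bundles using (Poset)
open import Relation.Binary.Structures using (IsPartialOrder; IsPreorder; IsEquivalence)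
open import Relation.Binary.Construct.Closure.Transitive using (TransClosure; [_]; _∷_; _++_)
import Relation.Binary.Construct.On as On

TransClosure-least : {a ℓ ℓ′ : Level} {A : Set a} {_∼_ : Rel A ℓ} {_≤_ : Rel A ℓ′} →
  Transitive _≤_ → _∼_ ⇒ _≤_ → TransClosure _∼_ ⇒ _≤_
TransClosure-least trans ∼⇒≤ [ x∼y ]        = ∼⇒≤ x∼y
TransClosure-least trans ∼⇒≤ (x∼y ∷ y∼⁺z) = trans (∼⇒≤ x∼y) (TransClosure-least trans ∼⇒≤ y∼⁺z)

module _ {c ℓ₁ ℓ₂ c' ℓ₁' ℓ₂' : Level} (P : Poset c ℓ₁ ℓ₂) (Q : Poset c' ℓ₁' ℓ₂')
         (f : Poset.Carrier P → Poset.Carrier Q) where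
  private
    module P = Poset P
    module Q = Poset Q
    θ = Kernel P Q f

  Kernel-isEquivalence : IsEquivalence θ
  Kernel-isEquivalence = On.isEquivalence f Q.isEquivalence

  QuotLeq⁺-isPreorder : IsPreorder θ (QuotLeq⁺ P θ)
  QuotLeq⁺-isPreorder = record
    { isEquivalence = Kernel-isEquivalence
    ; reflexive     = λ {x} x≈y → [ x , x , Q.Eq.refl , Q.Eq.sym x≈y , P.refl ]
    ; trans         = _++_
    }

  module _ (monotone : ∀ {x y} → x P.≤ y → f x Q.≤ f y) where

    QuotLeq⇒≤-on : QuotLeq P θ ⇒ (Q._≤_ on f)
    QuotLeq⇒≤-on (x' , y' , x≈x' , y≈y' , x'≤y') =
      Q.trans (Q.reflexive x≈x') (Q.trans (monotone x'≤y') (Q.reflexive (Q.Eq.sym y≈y')))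

    QuotLeq⁺⇒≤-on : QuotLeq⁺ P θ ⇒ (Q._≤_ on f)
    QuotLeq⁺⇒≤-on = TransClosure-least Q.trans QuotLeq⇒≤-on

    QuotLeq⁺-isPartialOrder : IsPartialOrder θ (QuotLeq⁺ P θ)
    QuotLeq⁺-isPartialOrder = record
      { isPreorder = QuotLeq⁺-isPreorder
      ; antisym    = λ x≤y y≤x → Q.antisym (QuotLeq⁺⇒≤-on x≤y) (QuotLeq⁺⇒≤-on y≤x)
      }

proposition6p20 : {c ℓ₁ ℓ₂ c' ℓ₁' ℓ₂' : Level}
    (P : Poset c ℓ₁ ℓ₂) (Q : Poset c' ℓ₁' ℓ₂')
    (f : Poset.Carrier P → Poset.Carrier Q) → IsContraction P Q f →
    IsPartialOrder (Kernel P Q f) (QuotLeq⁺ P (Kernel P Q f))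
proposition6p20 P Q f contraction =
  QuotLeq⁺-isPartialOrder P Q f (IsContraction.order-preserving contraction)
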